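{- Consider the following procedure. Input: a clause $C = L \lor C'$ (the candidate) and a clause $D = N_1 \lor \dots \lor N_n \lor D'$ (the partner), variable disjoint, without equality, where $N_1,\dots,N_n$ are exactly the literals of $D$ each of which is unifiable with $\bar L$. For $k = 1,\dots,n$: set $N := \{N_k\}$; while $L$ is unifiable with all literals in $\bar N = \{\bar M \mid M \in N\}$ via a most general unifier $\sigma$: let $K$ be the set of all pairs of complementary literals in the $L$-resolvent $C'\sigma \lor (D \setminus N)\sigma$; if $K = \emptyset$, return NO; if every pair in $K$ contains a literal of the form $N_i\sigma$, set $N := N \cup \{N_i \mid N_i\sigma \text{ is part of a complementary pair in } K\}$; otherwise leave the while loop. After the for loop, return YES. Then this procedure returns YES if and only if all $L$-resolvents of $C$ with $D$ are valid.
   Context: First-order logic without equality. A literal is an atom or a negated atom; $\bar L$ denotes the complement of $L$. Clauses are disjunctions of literals (multisets), with implicitly universally quantified variables. A clause (without equality) is valid iff it contains a pair of complementary literals. $L$-resolvent: given clauses $C = L \lor C'$ and $D = M_1 \lor \dots \lor M_l \lor D''$ with $l > 0$ (variable disjoint) such that $L, \bar M_1, \dots, \bar M_l$ are unifiable with most general unifier $\sigma$, the clause $C'\sigma \lor D''\sigma$ is an $L$-resolvent of $C$ and $D$. -}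

module Defs where

open import Data.Nat using (ℕ)
open import Data.Bool using (Bool; true; false)
open import Data.Fin using (Fin)
open import Data.List using (List; []; _∷_; map; _++_; length; lookup; allFin)
open import Data.List.Membership.Propositional using (_∈_)
open import Data.Vec using ([]; _∷_)
open import Data.Fin.Subset using (Subset; ⁅_⁆; Nonempty) renaming (_∈_ to _∈ₛ_; _∉_ to _∉ₛ_)
open import Data.Product using (Σ; ∃; _×_; _,_)
open import Data.Sum using (_⊎_; inj₁; inj₂)
open import Data.Empty using (⊥)
open import Relation.Nullary using (¬_)
open import Relation.Binary.PropositionalEquality using (_≡_)

data Term : Set where
  var : ℕ → Term
  fn  : ℕ → List Term → Term

data Atom : Set where
  atom : ℕ → List Term → Atom

data Lit : Set where
  pos : Atom → Lit
  neg : Atom → Lit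

comp : Lit → Lit
comp (pos a) = neg a
comp (neg a) = pos a

-- Clauses: disjunctions of literals, as multisets (represented by lists).
Clause : Set
Clause = List Lit

mutual
  data OccT (x : ℕ) : Term → Set where
    here : OccT x (var x)
    inFn : ∀ {f ts} → OccTs x ts → OccT x (fn f ts)

  data OccTs (x : ℕ) : List Term → Set where
    hd : ∀ {t ts} → OccT x t → OccTs x (t ∷ ts)
    tl : ∀ {t ts} → OccTs x ts → OccTs x (t ∷ ts)

OccA : ℕ → Atom → Set
OccA x (atom p ts) = OccTs x ts

OccL : ℕ → Lit → Set
OccL x (pos a) = OccA x a
OccL x (neg a) = OccA x a

OccC : ℕ → Clause → Set
OccC x C = ∃ λ M → M ∈ C × OccL x M

VariableDisjoint : Clause → Clause → Set
VariableDisjoint C D = ∀ x → OccC x C → ¬ OccC x D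

Sub : Set
Sub = ℕ → Term

mutual
  substT : Sub → Term → Term
  substT σ (var x)   = σ x
  substT σ (fn f ts) = fn f (substTs σ ts)

  substTs : Sub → List Term → List Term
  substTs σ []       = []
  substTs σ (t ∷ ts) = substT σ t ∷ substTs σ ts

substA : Sub → Atom → Atom
substA σ (atom p ts) = atom p (substTs σ ts)

substL : Sub → Lit → Lit
substL σ (pos a) = pos (substA σ a)
substL σ (neg a) = neg (substA σ a)

substC : Sub → Clause → Clause
substC σ C = map (substL σ) C

Unifies : Sub → List Lit → Set
Unifies σ Ls = ∀ {A B} → A ∈ Ls → B ∈ Ls → substL σ A ≡ substL σ B

Unifiable : List Lit → Set
Unifiable Ls = ∃ λ σ → Unifies σ Ls

IsMGU : Sub → List Lit → Set
IsMGU σ Ls = Unifies σ Ls ×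
             (∀ τ → Unifies τ Ls → ∃ λ ρ → ∀ x → τ x ≡ substT ρ (σ x))

-- Sub-multisets of a clause given by sets of positions

select : (D : Clause) → Subset (length D) → Clause
select []      []          = []
select (M ∷ D) (true  ∷ S) = M ∷ select D S
select (M ∷ D) (false ∷ S) = select D S

remove : (D : Clause) → Subset (length D) → Clause
remove []      []          = []
remove (M ∷ D) (true  ∷ S) = remove D S
remove (M ∷ D) (false ∷ S) = M ∷ remove D S

-- A clause (without equality) is valid iff it contains a pair of
-- complementary literals.
Valid : Clause → Set
Valid C = ∃ λ M → M ∈ C × comp M ∈ C

IsLResolvent : (L : Lit) (C' D : Clause) → Clause → Set
IsLResolvent L C' D R =
  Σ (Subset (length D)) λ S → Nonempty S ×
  Σ Sub λ σ → IsMGU σ (L ∷ map comp (select D S)) ×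
  R ≡ substC σ C' ++ substC σ (remove D S)

AllLResolventsValid : (L : Lit) (C' D : Clause) → Set
AllLResolventsValid L C' D = ∀ R → IsLResolvent L C' D R → Valid R

-- The procedure (relational semantics: any choice of mgu is allowed)

data Answer : Set where
  YES NO : Answer

data LoopOutcome : Set where
  leftLoop returnedNo : LoopOutcome

module Procedure (L : Lit) (C' D : Clause) where

  m : ℕ
  m = length D

  Cand : Fin m → Set
  Cand j = Unifiable (comp L ∷ lookup D j ∷ [])

  -- literal occurrences of the resolvent C'σ ∨ (D \ N)σ, remembering
  -- where they come from
  Pos : Subset m → Set
  Pos N = Fin (length C') ⊎ Σ (Fin m) (λ j → j ∉ₛ N)

  litAt : (N : Subset m) → Sub → Pos N → Lit
  litAt N σ (inj₁ i)       = substL σ (lookup C' i)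
  litAt N σ (inj₂ (j , _)) = substL σ (lookup D j)

  CompPair : (N : Subset m) → Sub → Pos N → Pos N → Set
  CompPair N σ p q = litAt N σ p ≡ comp (litAt N σ q)

  IsNOcc : (N : Subset m) → Pos N → Set
  IsNOcc N (inj₁ _)       = ⊥
  IsNOcc N (inj₂ (j , _)) = Cand j

  NewN : (N : Subset m) → Sub → Fin m → Set
  NewN N σ j = Cand j × Σ (j ∉ₛ N) λ nj →
               ∃ λ q → CompPair N σ (inj₂ (j , nj)) q

  data Loop (N : Subset m) : LoopOutcome → Set where
    notUnifiable : ¬ Unifiable (L ∷ map comp (select D N)) → Loop N leftLoop
    emptyK : (σ : Sub) → IsMGU σ (L ∷ map comp (select D N)) →
             (∀ p q → ¬ CompPair N σ p q) → Loop N returnedNo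
    grow : (σ : Sub) → IsMGU σ (L ∷ map comp (select D N)) →
           (∃ λ p → ∃ λ q → CompPair N σ p q) →
           (∀ p q → CompPair N σ p q → IsNOcc N p ⊎ IsNOcc N q) →
           (N' : Subset m) → (∀ j → (j ∈ₛ N' → j ∈ₛ N ⊎ NewN N σ j) ×
                                    (j ∈ₛ N ⊎ NewN N σ j → j ∈ₛ N')) →
           ∀ {r} → Loop N' r → Loop N r
    leave : (σ : Sub) → IsMGU σ (L ∷ map comp (select D N)) →
            (∃ λ p → ∃ λ q → CompPair N σ p q × ¬ IsNOcc N p × ¬ IsNOcc N q) →
            Loop N leftLoop

  -- the for loop over k = 1, …, n (positions of D, skipping non-N_i)
  data ForLoop : List (Fin m) → Answer → Set where
    finished : ForLoop [] YES
    skip     : ∀ {j js r} → ¬ Cand j → ForLoop js r → ForLoop (j ∷ js) r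
    next     : ∀ {j js r} → Cand j → Loop ⁅ j ⁆ leftLoop → ForLoop js r →
               ForLoop (j ∷ js) r
    stopNo   : ∀ {j js} → Cand j → Loop ⁅ j ⁆ returnedNo → ForLoop (j ∷ js) NO

  Returns : Answer → Set
  Returns r = ForLoop (allFin m) r

Returns : (L : Lit) (C' D : Clause) → Answer → Set
Returns L C' D r = Procedure.Returns L C' D r

module Submission where

-- If the procedure answers NO, some while loop found K = ∅: the L-resolvent
-- for the current N and its mgu has no complementary pair.
--
-- Conversely, take an L-resolvent R for positions S ∋ k and mgu σS, and follow
-- the while loop started with N = {k}.  While N ⊆ S, σS unifies L with N̄ and so
-- factors through the loop's mgu σ; hence a complementary pair of the loop's
-- resolvent with both literals from positions outside S yields one in R.  When
-- the loop is left, the chosen pair contains no N_iσ, and positions in S only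
-- hold literals unifiable with L̄.  When N outgrows S, a new N_j ∉ S lies in a
-- pair whose partner is not in S either: literals unifiable with L̄ all have the
-- sign of L̄, so no two of them are complementary.

open import Defs
open import Data.Bool using (Bool; true; false; not)
open import Data.Bool.Properties using (not-¬)
open import Data.Empty using (⊥-elim)
open import Data.Fin using (zero; suc)
open import Data.Fin.Properties using (any?)
open import Data.Fin.Subset using (Subset; ⁅_⁆; Nonempty; outside; inside)
  renaming (_∈_ to _∈ₛ_; _∉_ to _∉ₛ_; _⊆_ to _⊆ₛ_)
open import Data.Fin.Subset.Properties using (x∈⁅x⁆; x∈⁅y⁆⇒x≡y; _∈?_)
open import Data.List using ([]; _∷_; map; _++_; length; lookup)
open import Data.List.Membership.Propositional using (_∈_)
open import Data.List.Membership.Propositional.Properties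
  using (∈-lookup; ∈-allFin; ∈-map⁻; ∈-map⁺; ∈-++⁻; ∈-++⁺ˡ; ∈-++⁺ʳ)
open import Data.List.Relation.Binary.Subset.Propositional using (_⊆_)
open import Data.List.Relation.Binary.Subset.Propositional.Properties using (map⁺; ∷⁺ʳ)
open import Data.List.Relation.Unary.Any using (here; there; index)
open import Data.List.Relation.Unary.Any.Properties using (lookup-index)
open import Data.Product using (_×_; ∃; _,_; proj₁; proj₂)
open import Data.Sum using (_⊎_; inj₁; inj₂)
open import Data.Unit using (⊤; tt)
open import Data.Vec using (_∷_; []; here; there)
open import Function using (_∘_)
open import Relation.Nullary using (¬_; yes; no)
open import Relation.Nullary.Decidable using (_×-dec_; ¬?; decidable-stable)
open import Relation.Binary.PropositionalEquality
  using (_≡_; _≢_; refl; sym; trans; cong; cong₂; subst; module ≡-Reasoning)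

_≗_∘ₛ_ : Sub → Sub → Sub → Set
τ ≗ ρ ∘ₛ σ = ∀ x → τ x ≡ substT ρ (σ x)

mutual
  substT-∘ : ∀ {τ ρ σ} → τ ≗ ρ ∘ₛ σ → ∀ t → substT τ t ≡ substT ρ (substT σ t)
  substT-∘ τ≗ρσ (var x)   = τ≗ρσ x
  substT-∘ τ≗ρσ (fn f ts) = cong (fn f) (substTs-∘ τ≗ρσ ts)

  substTs-∘ : ∀ {τ ρ σ} → τ ≗ ρ ∘ₛ σ → ∀ ts → substTs τ ts ≡ substTs ρ (substTs σ ts)
  substTs-∘ τ≗ρσ []       = refl
  substTs-∘ τ≗ρσ (t ∷ ts) = cong₂ _∷_ (substT-∘ τ≗ρσ t) (substTs-∘ τ≗ρσ ts)

substL-∘ : ∀ {τ ρ σ} → τ ≗ ρ ∘ₛ σ → ∀ M → substL τ M ≡ substL ρ (substL σ M)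
substL-∘ τ≗ρσ (pos (atom p ts)) = cong (λ us → pos (atom p us)) (substTs-∘ τ≗ρσ ts)
substL-∘ τ≗ρσ (neg (atom p ts)) = cong (λ us → neg (atom p us)) (substTs-∘ τ≗ρσ ts)

substL-comp : ∀ σ M → substL σ (comp M) ≡ comp (substL σ M)
substL-comp σ (pos a) = refl
substL-comp σ (neg a) = refl

comp-involutive : ∀ M → comp (comp M) ≡ M
comp-involutive (pos a) = refl
comp-involutive (neg a) = refl

complementary-∘ : ∀ {τ ρ σ} → τ ≗ ρ ∘ₛ σ → ∀ {A B} →
                  substL σ A ≡ comp (substL σ B) → substL τ A ≡ comp (substL τ B)
complementary-∘ {τ} {ρ} {σ} τ≗ρσ {A} {B} σA≡σB̄ = begin
  substL τ A                   ≡⟨ substL-∘ τ≗ρσ A ⟩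
  substL ρ (substL σ A)        ≡⟨ cong (substL ρ) σA≡σB̄ ⟩
  substL ρ (comp (substL σ B)) ≡⟨ substL-comp ρ (substL σ B) ⟩
  comp (substL ρ (substL σ B)) ≡⟨ cong comp (sym (substL-∘ τ≗ρσ B)) ⟩
  comp (substL τ B)            ∎
  where open ≡-Reasoning

positive : Lit → Bool
positive (pos _) = true
positive (neg _) = false

positive-substL : ∀ σ M → positive (substL σ M) ≡ positive M
positive-substL σ (pos a) = refl
positive-substL σ (neg a) = refl

positive-comp : ∀ M → positive (comp M) ≡ not (positive M)
positive-comp (pos a) = refl
positive-comp (neg a) = refl

unified⇒same-polarity : ∀ σ {A B} → substL σ A ≡ substL σ B → positive A ≡ positive B
unified⇒same-polarity σ {A} {B} σA≡σB =
  trans (sym (positive-substL σ A)) (trans (cong positive σA≡σB) (positive-substL σ B))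

complementary⇒opposite-polarity : ∀ σ {A B} → substL σ A ≡ comp (substL σ B) →
                                  positive A ≡ not (positive B)
complementary⇒opposite-polarity σ {A} {B} σA≡σB̄ =
  trans (unified⇒same-polarity σ (trans σA≡σB̄ (sym (substL-comp σ B)))) (positive-comp B)

unifies-pair : ∀ σ {A B} → substL σ A ≡ substL σ B → Unifies σ (A ∷ B ∷ [])
unifies-pair σ σA≡σB (here refl)         (here refl)         = refl
unifies-pair σ σA≡σB (here refl)         (there (here refl)) = σA≡σB
unifies-pair σ σA≡σB (there (here refl)) (here refl)         = sym σA≡σB
unifies-pair σ σA≡σB (there (here refl)) (there (here refl)) = refl

Unifies-⊆ : ∀ {σ Ks Ls} → Ks ⊆ Ls → Unifies σ Ls → Unifies σ Ks
Unifies-⊆ Ks⊆Ls unifies A∈Ks B∈Ks = unifies (Ks⊆Ls A∈Ks) (Ks⊆Ls B∈Ks)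

Valid-complementary : ∀ {R A B} → A ∈ R → B ∈ R → A ≡ comp B → Valid R
Valid-complementary {R} A∈R B∈R A≡B̄ = _ , B∈R , subst (_∈ R) A≡B̄ A∈R

⊆ₛ⊎∃∈∖ : ∀ {n} (N S : Subset n) → N ⊆ₛ S ⊎ ∃ λ j → j ∈ₛ N × j ∉ₛ S
⊆ₛ⊎∃∈∖ N S with any? (λ j → (j ∈? N) ×-dec ¬? (j ∈? S))
... | yes escape = inj₂ escape
... | no ¬escape = inj₁ λ {j} j∈N → decidable-stable (j ∈? S) (λ j∉S → ¬escape (j , j∈N , j∉S))

lookup∈select : ∀ D (S : Subset (length D)) {j} → j ∈ₛ S → lookup D j ∈ select D S
lookup∈select (M ∷ D) (inside ∷ S)  here      = here refl
lookup∈select (M ∷ D) (inside ∷ S)  (there p) = there (lookup∈select D S p)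
lookup∈select (M ∷ D) (outside ∷ S) (there p) = lookup∈select D S p

∈select⇒lookup : ∀ D (S : Subset (length D)) {M} → M ∈ select D S →
                 ∃ λ j → j ∈ₛ S × M ≡ lookup D j
∈select⇒lookup [] [] ()
∈select⇒lookup (M ∷ D) (inside ∷ S) (here M≡) = _ , here , M≡
∈select⇒lookup (M ∷ D) (inside ∷ S) (there p) with ∈select⇒lookup D S p
... | j , j∈S , M≡ = suc j , there j∈S , M≡
∈select⇒lookup (M ∷ D) (outside ∷ S) p with ∈select⇒lookup D S p
... | j , j∈S , M≡ = suc j , there j∈S , M≡

lookup∈remove : ∀ D (S : Subset (length D)) {j} → j ∉ₛ S → lookup D j ∈ remove D S
lookup∈remove (M ∷ D) (inside ∷ S)  {zero}  j∉S = ⊥-elim (j∉S here)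
lookup∈remove (M ∷ D) (inside ∷ S)  {suc j} j∉S = lookup∈remove D S (λ j∈S → j∉S (there j∈S))
lookup∈remove (M ∷ D) (outside ∷ S) {zero}  j∉S = here refl
lookup∈remove (M ∷ D) (outside ∷ S) {suc j} j∉S = there (lookup∈remove D S (λ j∈S → j∉S (there j∈S)))

∈remove⇒lookup : ∀ D (S : Subset (length D)) {M} → M ∈ remove D S →
                 ∃ λ j → j ∉ₛ S × M ≡ lookup D j
∈remove⇒lookup [] [] ()
∈remove⇒lookup (M ∷ D) (inside ∷ S) p with ∈remove⇒lookup D S p
... | j , j∉S , M≡ = suc j , (λ { (there j∈S) → j∉S j∈S }) , M≡
∈remove⇒lookup (M ∷ D) (outside ∷ S) (here M≡) = zero , (λ ()) , M≡
∈remove⇒lookup (M ∷ D) (outside ∷ S) (there p) with ∈remove⇒lookup D S p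
... | j , j∉S , M≡ = suc j , (λ { (there j∈S) → j∉S j∈S }) , M≡

select-mono : ∀ D {N S : Subset (length D)} → N ⊆ₛ S → select D N ⊆ select D S
select-mono D {N} {S} N⊆S M∈N with ∈select⇒lookup D N M∈N
... | j , j∈N , refl = lookup∈select D S (N⊆S j∈N)

module LResolventProcedure (L : Lit) (C' D : Clause) where
  open Procedure L C' D hiding (Returns)

  UnifiesL : Sub → Subset m → Set
  UnifiesL σ N = Unifies σ (L ∷ map comp (select D N))

  UnifiesL-⊆ : ∀ {σ N S} → N ⊆ₛ S → UnifiesL σ S → UnifiesL σ N
  UnifiesL-⊆ N⊆S = Unifies-⊆ (∷⁺ʳ L (map⁺ comp (select-mono D N⊆S)))

  UnifiesL⇒Cand : ∀ {σ S j} → UnifiesL σ S → j ∈ₛ S → Cand j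
  UnifiesL⇒Cand {σ} {S} {j} σ-unifies j∈S = σ , unifies-pair σ (begin
    substL σ (comp L)                    ≡⟨ substL-comp σ L ⟩
    comp (substL σ L)                    ≡⟨ cong comp (σ-unifies (here refl) L̄∈) ⟩
    comp (substL σ (comp (lookup D j)))  ≡⟨ cong comp (substL-comp σ (lookup D j)) ⟩
    comp (comp (substL σ (lookup D j)))  ≡⟨ comp-involutive _ ⟩
    substL σ (lookup D j)                ∎)
    where
    open ≡-Reasoning
    L̄∈ : comp (lookup D j) ∈ L ∷ map comp (select D S)
    L̄∈ = there (∈-map⁺ comp (lookup∈select D S j∈S))

  Cand⇒polarity : ∀ {j} → Cand j → positive (lookup D j) ≡ positive (comp L)
  Cand⇒polarity (τ , τ-unifies) = sym (unified⇒same-polarity τ (τ-unifies (here refl) (there (here refl))))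

  Cand-noncomplementary : ∀ σ {j j'} → Cand j → Cand j' →
                          substL σ (lookup D j) ≢ comp (substL σ (lookup D j'))
  Cand-noncomplementary σ cj cj' =
    not-¬ (trans (Cand⇒polarity cj) (sym (Cand⇒polarity cj'))) ∘ complementary⇒opposite-polarity σ

  origin : ∀ {N} → Pos N → Lit
  origin (inj₁ i)       = lookup C' i
  origin (inj₂ (j , _)) = lookup D j

  litAt≡substL-origin : ∀ {N} σ (p : Pos N) → litAt N σ p ≡ substL σ (origin p)
  litAt≡substL-origin σ (inj₁ i)       = refl
  litAt≡substL-origin σ (inj₂ (j , _)) = refl

  ∈resolvent⇒litAt : ∀ N σ {X} → X ∈ substC σ C' ++ substC σ (remove D N) →
                     ∃ λ (p : Pos N) → litAt N σ p ≡ X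
  ∈resolvent⇒litAt N σ X∈ with ∈-++⁻ (substC σ C') X∈
  ... | inj₁ X∈C'σ with ∈-map⁻ (substL σ) X∈C'σ
  ...   | M , M∈C' , refl = inj₁ (index M∈C') , cong (substL σ) (sym (lookup-index M∈C'))
  ∈resolvent⇒litAt N σ X∈ | inj₂ X∈Dσ with ∈-map⁻ (substL σ) X∈Dσ
  ...   | M , M∈D∖N , refl with ∈remove⇒lookup D N M∈D∖N
  ...     | j , j∉N , refl = inj₂ (j , j∉N) , refl

  Loop-returnedNo⇒invalid-resolvent : ∀ {N} → Loop N returnedNo → Nonempty N →
                                      ∃ λ R → IsLResolvent L C' D R × ¬ Valid R
  Loop-returnedNo⇒invalid-resolvent {N} (emptyK σ mgu K≡∅) N≢∅ =
    _ , (N , N≢∅ , σ , mgu , refl) , ¬valid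
    where
    ¬valid : ¬ Valid (substC σ C' ++ substC σ (remove D N))
    ¬valid (X , X∈ , X̄∈) with ∈resolvent⇒litAt N σ X∈ | ∈resolvent⇒litAt N σ X̄∈
    ... | p , refl | q , q≡X̄ = K≡∅ p q (trans (sym (comp-involutive _)) (cong comp (sym q≡X̄)))
  Loop-returnedNo⇒invalid-resolvent (grow σ _ _ _ N' N'-spec loop) (j , j∈N) =
    Loop-returnedNo⇒invalid-resolvent loop (j , proj₂ (N'-spec j) (inj₁ j∈N))

  module Resolvent {S : Subset m} {σS : Sub} (σS-unifies : UnifiesL σS S) where

    R : Clause
    R = substC σS C' ++ substC σS (remove D S)

    Survives : ∀ {N} → Pos N → Set
    Survives (inj₁ _)       = ⊤
    Survives (inj₂ (j , _)) = j ∉ₛ S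

    survivor∈R : ∀ {N} (p : Pos N) → Survives p → substL σS (origin p) ∈ R
    survivor∈R (inj₁ i)       _   = ∈-++⁺ˡ (∈-map⁺ (substL σS) (∈-lookup {xs = C'} i))
    survivor∈R (inj₂ (j , _)) j∉S =
      ∈-++⁺ʳ (substC σS C') (∈-map⁺ (substL σS) (lookup∈remove D S j∉S))

    mgu-factors : ∀ {N σ} → IsMGU σ (L ∷ map comp (select D N)) → N ⊆ₛ S → ∃ λ ρ → σS ≗ ρ ∘ₛ σ
    mgu-factors mgu N⊆S = proj₂ mgu σS (UnifiesL-⊆ N⊆S σS-unifies)

    surviving-pair⇒Valid : ∀ {N σ} → (∃ λ ρ → σS ≗ ρ ∘ₛ σ) → (p q : Pos N) →
                           CompPair N σ p q → Survives p → Survives q → Valid R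
    surviving-pair⇒Valid {N} {σ} (ρ , σS≗ρσ) p q pq p-survives q-survives =
      Valid-complementary (survivor∈R p p-survives) (survivor∈R q q-survives)
        (complementary-∘ σS≗ρσ
          (trans (sym (litAt≡substL-origin σ p)) (trans pq (cong comp (litAt≡substL-origin σ q)))))

    ¬IsNOcc⇒Survives : ∀ {N} (p : Pos N) → ¬ IsNOcc N p → Survives p
    ¬IsNOcc⇒Survives (inj₁ _)       _      = tt
    ¬IsNOcc⇒Survives (inj₂ (j , _)) ¬cand j∈S = ¬cand (UnifiesL⇒Cand σS-unifies j∈S)

    partner-of-Cand-survives : ∀ {N σ j} (j∉N : j ∉ₛ N) q → Cand j →
                               CompPair N σ (inj₂ (j , j∉N)) q → Survives q
    partner-of-Cand-survives _ (inj₁ _) _  _  = tt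
    partner-of-Cand-survives {σ = σ} _ (inj₂ _) cj pq j'∈S =
      Cand-noncomplementary σ cj (UnifiesL⇒Cand σS-unifies j'∈S) pq

    Loop-leftLoop⇒Valid : ∀ {N} → Loop N leftLoop → N ⊆ₛ S → Valid R
    Loop-leftLoop⇒Valid (notUnifiable ¬unifiable) N⊆S =
      ⊥-elim (¬unifiable (σS , UnifiesL-⊆ N⊆S σS-unifies))
    Loop-leftLoop⇒Valid (leave σ mgu (p , q , pq , ¬Np , ¬Nq)) N⊆S =
      surviving-pair⇒Valid (mgu-factors mgu N⊆S) p q pq
        (¬IsNOcc⇒Survives p ¬Np) (¬IsNOcc⇒Survives q ¬Nq)
    Loop-leftLoop⇒Valid (grow σ mgu _ _ N' N'-spec loop) N⊆S with ⊆ₛ⊎∃∈∖ N' S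
    ... | inj₁ N'⊆S = Loop-leftLoop⇒Valid loop N'⊆S
    ... | inj₂ (j , j∈N' , j∉S) with proj₁ (N'-spec j) j∈N'
    ...   | inj₁ j∈N                  = ⊥-elim (j∉S (N⊆S j∈N))
    ...   | inj₂ (cj , j∉N , q , pq) =
      surviving-pair⇒Valid (mgu-factors mgu N⊆S) (inj₂ (j , j∉N)) q pq j∉S
        (partner-of-Cand-survives j∉N q cj pq)

  ForLoop-YES⇒Loop-leftLoop : ∀ {js k} → ForLoop js YES → k ∈ js → Cand k → Loop ⁅ k ⁆ leftLoop
  ForLoop-YES⇒Loop-leftLoop (skip ¬ck _)   (here refl) ck = ⊥-elim (¬ck ck)
  ForLoop-YES⇒Loop-leftLoop (next _ loop _) (here refl) _  = loop
  ForLoop-YES⇒Loop-leftLoop (skip _ rest)   (there k∈) ck = ForLoop-YES⇒Loop-leftLoop rest k∈ ck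
  ForLoop-YES⇒Loop-leftLoop (next _ _ rest) (there k∈) ck = ForLoop-YES⇒Loop-leftLoop rest k∈ ck

  ForLoop-NO⇒Loop-returnedNo : ∀ {js} → ForLoop js NO → ∃ λ k → Loop ⁅ k ⁆ returnedNo
  ForLoop-NO⇒Loop-returnedNo (skip _ rest)       = ForLoop-NO⇒Loop-returnedNo rest
  ForLoop-NO⇒Loop-returnedNo (next _ _ rest)     = ForLoop-NO⇒Loop-returnedNo rest
  ForLoop-NO⇒Loop-returnedNo (stopNo {k} _ loop) = k , loop

  Returns-YES⇒AllLResolventsValid : Returns L C' D YES → AllLResolventsValid L C' D
  Returns-YES⇒AllLResolventsValid returns R (S , (k , k∈S) , σ , mgu , refl) =
    Resolvent.Loop-leftLoop⇒Valid (proj₁ mgu) loop ⁅k⁆⊆S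
    where
    loop : Loop ⁅ k ⁆ leftLoop
    loop = ForLoop-YES⇒Loop-leftLoop returns (∈-allFin k) (UnifiesL⇒Cand (proj₁ mgu) k∈S)
    ⁅k⁆⊆S : ⁅ k ⁆ ⊆ₛ S
    ⁅k⁆⊆S j∈⁅k⁆ = subst (_∈ₛ S) (sym (x∈⁅y⁆⇒x≡y k j∈⁅k⁆)) k∈S

  Returns-NO⇒¬AllLResolventsValid : Returns L C' D NO → ¬ AllLResolventsValid L C' D
  Returns-NO⇒¬AllLResolventsValid returns allValid with ForLoop-NO⇒Loop-returnedNo returns
  ... | k , loop with Loop-returnedNo⇒invalid-resolvent loop (k , x∈⁅x⁆ k)
  ...   | R , R-resolvent , ¬valid = ¬valid (allValid R R-resolvent)

theorem5 : (L : Lit) (C' D : Clause) → VariableDisjoint (L ∷ C') D →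
    (r : Answer) → Returns L C' D r →
    (r ≡ YES → AllLResolventsValid L C' D) × (AllLResolventsValid L C' D → r ≡ YES)
theorem5 L C' D _ YES returns = (λ _ → Returns-YES⇒AllLResolventsValid returns) , (λ _ → refl)
  where open LResolventProcedure L C' D
theorem5 L C' D _ NO returns =
  (λ ()) , λ allValid → ⊥-elim (Returns-NO⇒¬AllLResolventsValid returns allValid)
  where open LResolventProcedure L C' D
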